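{- Let $m,n\ge 0$ be integers and let $G$ be an SP-game whose legal complex is the simplex $\Delta_G=\langle\{x_1,\dots,x_m,y_1,\dots,y_n\}\rangle$, where $x_1,\dots,x_m$ are Left vertices and $y_1,\dots,y_n$ are Right vertices. Then $G$ has value $m-n$.
   Context: Games are two-player (Left, Right) short combinatorial games under normal play; game value means equivalence class under $G=H$ iff $G-H$ is a second-player win. An SP-game is a placement game on an initially empty board in which pieces are never moved or removed and in which any sequence of moves leading to a reachable position consists of legal moves. Its legal complex $\Delta_G$ has one vertex per basic position (single-piece position), Left basic positions written $x_i$ and Right ones $y_j$, with a set of vertices a face iff the corresponding pieces together form a legal position. From the position corresponding to face $F$, Left (resp. Right) may move to $F\cup\{v\}$ for any Left (resp. Right) vertex $v\notin F$ with $F\cup\{v\}\in\Delta_G$. $\langle F_1,\dots,F_k\rangle$ denotes the simplicial complex with facets $F_1,\dots,F_k$. Integers as games: $0=\{\,\mid\,\}$, $n=\{n-1\mid\,\}$ for $n>0$, $n=\{\,\mid n+1\}$ for $n<0$. -}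

module Defs where

open import Data.Nat using (ℕ; zero; suc; _+_)
open import Data.Integer using (ℤ; +_; -[1+_])
open import Data.Fin using (Fin)
open import Data.Fin.Subset using (Subset; ⁅_⁆; _∪_; _∈_; _∉_; _⊆_; ⊥)
open import Data.Fin.Subset.Properties using (_∈?_)
open import Data.List using (List; []; _∷_; _++_; map; filter; allFin)
open import Data.List.Membership.Propositional renaming (_∈_ to _∈ₗ_)
open import Data.Product using (_×_)
open import Data.Unit using (⊤; tt)
open import Relation.Nullary using (Dec; ¬?)
open import Relation.Nullary.Decidable using (_×-dec_)

data Game : Set where
  ⟨_∣_⟩ : List Game → List Game → Game

mutual
  data LeftWinsFirst : Game → Set where
    lmove : ∀ {L R G} → G ∈ₗ L → LeftWinsSecond G → LeftWinsFirst ⟨ L ∣ R ⟩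

  data LeftWinsSecond : Game → Set where
    lreply : ∀ {L R} → (∀ {G} → G ∈ₗ R → LeftWinsFirst G) → LeftWinsSecond ⟨ L ∣ R ⟩

mutual
  data RightWinsFirst : Game → Set where
    rmove : ∀ {L R G} → G ∈ₗ R → RightWinsSecond G → RightWinsFirst ⟨ L ∣ R ⟩

  data RightWinsSecond : Game → Set where
    rreply : ∀ {L R} → (∀ {G} → G ∈ₗ L → RightWinsFirst G) → RightWinsSecond ⟨ L ∣ R ⟩

SecondPlayerWin : Game → Set
SecondPlayerWin G = LeftWinsSecond G × RightWinsSecond G

mutual
  -_ : Game → Game
  - ⟨ L ∣ R ⟩ = ⟨ negs R ∣ negs L ⟩

  negs : List Game → List Game
  negs [] = []
  negs (g ∷ gs) = (- g) ∷ negs gs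

mutual
  _⊕_ : Game → Game → Game
  G@(⟨ GL ∣ GR ⟩) ⊕ H@(⟨ HL ∣ HR ⟩) =
    ⟨ addL GL H ++ addR G HL ∣ addL GR H ++ addR G HR ⟩

  addL : List Game → Game → List Game
  addL [] H = []
  addL (g ∷ gs) H = (g ⊕ H) ∷ addL gs H

  addR : Game → List Game → List Game
  addR G [] = []
  addR G (h ∷ hs) = (G ⊕ h) ∷ addR G hs

_≈_ : Game → Game → Set
G ≈ H = SecondPlayerWin (G ⊕ (- H))

natGame : ℕ → Game
natGame zero = ⟨ [] ∣ [] ⟩
natGame (suc n) = ⟨ natGame n ∷ [] ∣ [] ⟩

-- negGame k is the game -(k+1)
negGame : ℕ → Game
negGame zero = ⟨ [] ∣ natGame zero ∷ [] ⟩
negGame (suc k) = ⟨ [] ∣ negGame k ∷ [] ⟩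

intGame : ℤ → Game
intGame (+ n) = natGame n
intGame -[1+ k ] = negGame k

-- Simplicial complexes on m Left vertices x_i (Fin m) and n Right
-- vertices y_j (Fin n).  A set of vertices is a pair (A , B) of subsets.

record LegalComplex (m n : ℕ) : Set₁ where
  field
    Face      : Subset m → Subset n → Set
    face?     : ∀ A B → Dec (Face A B)
    downward  : ∀ {A A′ B B′} → A′ ⊆ A → B′ ⊆ B → Face A B → Face A′ B′
    vertexL   : ∀ i → Face ⁅ i ⁆ ⊥
    vertexR   : ∀ j → Face ⊥ ⁅ j ⁆

-- The fuel
-- argument only ensures structural termination: every move adds a new
-- vertex, so fuel m + n from the empty position is never exhausted early.
module _ {m n : ℕ} (Δ : LegalComplex m n) where
  open LegalComplex Δ

  positionGame : ℕ → Subset m → Subset n → Game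
  positionGame zero A B = ⟨ [] ∣ [] ⟩
  positionGame (suc f) A B =
    ⟨ map (λ i → positionGame f (A ∪ ⁅ i ⁆) B)
          (filter (λ i → ¬? (i ∈? A) ×-dec face? (A ∪ ⁅ i ⁆) B) (allFin m))
    ∣ map (λ j → positionGame f A (B ∪ ⁅ j ⁆))
          (filter (λ j → ¬? (j ∈? B) ×-dec face? A (B ∪ ⁅ j ⁆)) (allFin n)) ⟩

  spGame : Game
  spGame = positionGame (m + n) ⊥ ⊥

simplex : (m n : ℕ) → LegalComplex m n
simplex m n = record
  { Face = λ _ _ → ⊤
  ; face? = λ _ _ → Dec.yes tt
  ; downward = λ _ _ _ → tt
  ; vertexL = λ _ → tt
  ; vertexR = λ _ → tt
  }
  where open import Relation.Nullary as Dec using ()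

-- In the simplex every vertex stays playable until it is used, so in the
-- SP-game Left has exactly m moves and Right exactly n, whatever the order of
-- play: it is a pure countdown of m Left moves against n Right moves.  The
-- integer games are countdowns too, countdowns are closed under negation
-- (swapping the counts) and sum (adding them), and a countdown with equal
-- counts is a second-player win, since each player can always answer a move
-- of the opponent.  Hence G - (m - n) is a second-player win.
module Submission where

open import Defs
open import Data.Nat using (ℕ; zero; suc; _+_; _∸_; _≤_; _<_; s≤s; s≤s⁻¹)
open import Data.Integer using (+_; _-_; _⊖_)
open import Data.Nat.Properties
  using (≤-refl; ≤-reflexive; +-suc; +-identityʳ; n≤0⇒n≡0; m+n≡0⇒m≡0; m+n≡0⇒n≡0; 0≢1+n)
open import Data.Integer.Properties using (m-n≡m⊖n; [1+m]⊖[1+n]≡m⊖n)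
open import Data.Fin using (Fin; zero; suc)
open import Data.Fin.Subset using (Subset; ⁅_⁆; _∪_; _∉_; ⊥; ∁; ∣_∣; inside; outside; Nonempty)
open import Data.Fin.Subset.Properties
  using (∪-identityʳ; ∣⊥∣≡0; ∣∁p∣≡n∸∣p∣; x∈∁p⇒x∉p; nonempty?; Empty-unique; _∈?_)
open import Data.Vec using (_∷_; here; there)
open import Data.List using (List; []; _∷_; _++_; map; allFin)
open import Data.List.Membership.Propositional using () renaming (_∈_ to _∈ₗ_)
open import Data.List.Membership.Propositional.Properties
  using (∈-map⁻; ∈-map⁺; ∈-++⁻; ∈-++⁺ˡ; ∈-++⁺ʳ; ∈-filter⁺; ∈-filter⁻; ∈-allFin)
open import Data.List.Relation.Unary.Any using (here)
open import Data.Product using (_×_; _,_; ∃-syntax)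
open import Data.Sum using (_⊎_; inj₁; inj₂)
open import Data.Unit using (tt)
open import Data.Empty using (⊥-elim)
open import Function using (_∘_)
open import Relation.Binary.PropositionalEquality
open import Relation.Nullary using (yes; no; ¬?)
open import Relation.Nullary.Decidable using (_×-dec_)

variable
  a b c d k : ℕ
  G H g h : Game
  gs : List Game

leftOptions : Game → List Game
leftOptions ⟨ L ∣ _ ⟩ = L

rightOptions : Game → List Game
rightOptions ⟨ _ ∣ R ⟩ = R

-- The options of a player with exactly a moves left: each option leaves
-- a − 1 of them (so there is none when a = 0), and one exists when a > 0.
CountsDown : ℕ → (ℕ → Game → Set) → List Game → Set
CountsDown a P options =
  (∀ {g} → g ∈ₗ options → ∃[ a′ ] (a ≡ suc a′ × P a′ g)) ×
  (∀ {a′} → a ≡ suc a′ → ∃[ g ] g ∈ₗ options)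

-- Countdown a b G: in G Left has exactly a moves and Right exactly b moves,
-- independently of the order in which they are played.
data Countdown : ℕ → ℕ → Game → Set where
  countdown : ∀ {L R} →
    CountsDown a (λ a′ → Countdown a′ b) L →
    CountsDown b (λ b′ → Countdown a b′) R →
    Countdown a b ⟨ L ∣ R ⟩

mutual
  Countdown⇒LeftWinsSecond : Countdown a b G → b ≤ a → LeftWinsSecond G
  Countdown⇒LeftWinsSecond {a} {b} (countdown _ (rightMove , _)) b≤a =
    lreply (answer ∘ rightMove)
    where
    answer : ∃[ b′ ] (b ≡ suc b′ × Countdown a b′ g) → LeftWinsFirst g
    answer (_ , refl , c) = Countdown⇒LeftWinsFirst c b≤a

  Countdown⇒LeftWinsFirst : Countdown a b G → b < a → LeftWinsFirst G
  Countdown⇒LeftWinsFirst (countdown (leftMove , leftExists) _) (s≤s b≤a)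
    with leftExists refl
  ... | _ , g∈L with leftMove g∈L
  ... | _ , refl , c = lmove g∈L (Countdown⇒LeftWinsSecond c b≤a)

mutual
  Countdown⇒RightWinsSecond : Countdown a b G → a ≤ b → RightWinsSecond G
  Countdown⇒RightWinsSecond {a} {b} (countdown (leftMove , _) _) a≤b =
    rreply (answer ∘ leftMove)
    where
    answer : ∃[ a′ ] (a ≡ suc a′ × Countdown a′ b g) → RightWinsFirst g
    answer (_ , refl , c) = Countdown⇒RightWinsFirst c a≤b

  Countdown⇒RightWinsFirst : Countdown a b G → a < b → RightWinsFirst G
  Countdown⇒RightWinsFirst (countdown _ (rightMove , rightExists)) (s≤s a≤b)
    with rightExists refl
  ... | _ , g∈R with rightMove g∈R
  ... | _ , refl , c = rmove g∈R (Countdown⇒RightWinsSecond c a≤b)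

Countdown⇒SecondPlayerWin : Countdown a b G → a ≡ b → SecondPlayerWin G
Countdown⇒SecondPlayerWin c refl =
  Countdown⇒LeftWinsSecond c ≤-refl , Countdown⇒RightWinsSecond c ≤-refl

negs≡map : ∀ gs → negs gs ≡ map (-_) gs
negs≡map []       = refl
negs≡map (g ∷ gs) = cong (- g ∷_) (negs≡map gs)

addL≡map : ∀ gs H → addL gs H ≡ map (_⊕ H) gs
addL≡map []       H = refl
addL≡map (g ∷ gs) H = cong (g ⊕ H ∷_) (addL≡map gs H)

addR≡map : ∀ G gs → addR G gs ≡ map (G ⊕_) gs
addR≡map G []       = refl
addR≡map G (g ∷ gs) = cong (G ⊕ g ∷_) (addR≡map G gs)

∈-negs⁻ : g ∈ₗ negs gs → ∃[ h ] (h ∈ₗ gs × g ≡ - h)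
∈-negs⁻ {gs = gs} = ∈-map⁻ (-_) ∘ subst (_ ∈ₗ_) (negs≡map gs)

∈-negs⁺ : h ∈ₗ gs → - h ∈ₗ negs gs
∈-negs⁺ {gs = gs} = subst (_ ∈ₗ_) (sym (negs≡map gs)) ∘ ∈-map⁺ (-_)

∈-addL⁻ : g ∈ₗ addL gs H → ∃[ h ] (h ∈ₗ gs × g ≡ h ⊕ H)
∈-addL⁻ {gs = gs} {H} = ∈-map⁻ (_⊕ H) ∘ subst (_ ∈ₗ_) (addL≡map gs H)

∈-addL⁺ : h ∈ₗ gs → h ⊕ H ∈ₗ addL gs H
∈-addL⁺ {gs = gs} {H = H} = subst (_ ∈ₗ_) (sym (addL≡map gs H)) ∘ ∈-map⁺ (_⊕ H)

∈-addR⁻ : g ∈ₗ addR G gs → ∃[ h ] (h ∈ₗ gs × g ≡ G ⊕ h)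
∈-addR⁻ {G = G} {gs} = ∈-map⁻ (G ⊕_) ∘ subst (_ ∈ₗ_) (addR≡map G gs)

∈-addR⁺ : h ∈ₗ gs → G ⊕ h ∈ₗ addR G gs
∈-addR⁺ {gs = gs} {G = G} = subst (_ ∈ₗ_) (sym (addR≡map G gs)) ∘ ∈-map⁺ (G ⊕_)

Countdown-neg : Countdown a b G → Countdown b a (- G)
Countdown-neg {a} {b} (countdown {L = L} {R} (leftMove , leftExists) (rightMove , rightExists)) =
  countdown (negRightMove , negRightExists) (negLeftMove , negLeftExists)
  where
  negRightMove : g ∈ₗ negs R → ∃[ b′ ] (b ≡ suc b′ × Countdown b′ a g)
  negRightMove g∈ with ∈-negs⁻ g∈
  ... | _ , h∈R , refl with rightMove h∈R
  ... | b′ , b≡ , c = b′ , b≡ , Countdown-neg c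

  negRightExists : b ≡ suc k → ∃[ g ] g ∈ₗ negs R
  negRightExists b≡ with rightExists b≡
  ... | h , h∈R = - h , ∈-negs⁺ h∈R

  negLeftMove : g ∈ₗ negs L → ∃[ a′ ] (a ≡ suc a′ × Countdown b a′ g)
  negLeftMove g∈ with ∈-negs⁻ g∈
  ... | _ , h∈L , refl with leftMove h∈L
  ... | a′ , a≡ , c = a′ , a≡ , Countdown-neg c

  negLeftExists : a ≡ suc k → ∃[ g ] g ∈ₗ negs L
  negLeftExists a≡ with leftExists a≡
  ... | h , h∈L = - h , ∈-negs⁺ h∈L

m+n≡1+o⇒m≡1+p⊎n≡1+o : ∀ m {n o} → m + n ≡ suc o → (∃[ p ] m ≡ suc p) ⊎ n ≡ suc o
m+n≡1+o⇒m≡1+p⊎n≡1+o zero    n≡ = inj₂ n≡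
m+n≡1+o⇒m≡1+p⊎n≡1+o (suc m) _  = inj₁ (m , refl)

Countdown-⊕ : Countdown a b G → Countdown c d H → Countdown (a + c) (b + d) (G ⊕ H)
Countdown-⊕ {a} {b} {G} {c} {d} {H}
  cG@(countdown {L = GL} {GR} (leftMoveG , leftExistsG) (rightMoveG , rightExistsG))
  cH@(countdown {L = HL} {HR} (leftMoveH , leftExistsH) (rightMoveH , rightExistsH)) =
  countdown (leftMove , leftExists) (rightMove , rightExists)
  where
  leftMove : g ∈ₗ addL GL H ++ addR G HL → ∃[ k ] (a + c ≡ suc k × Countdown k (b + d) g)
  leftMove g∈ with ∈-++⁻ (addL GL H) g∈
  ... | inj₁ g∈GL+H with ∈-addL⁻ g∈GL+H
  ...   | _ , x∈GL , refl with leftMoveG x∈GL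
  ...     | a′ , refl , cx = a′ + c , refl , Countdown-⊕ cx cH
  leftMove g∈ | inj₂ g∈G+HL with ∈-addR⁻ g∈G+HL
  ...   | _ , x∈HL , refl with leftMoveH x∈HL
  ...     | c′ , refl , cx = a + c′ , +-suc a c′ , Countdown-⊕ cG cx

  leftExists : a + c ≡ suc k → ∃[ g ] g ∈ₗ addL GL H ++ addR G HL
  leftExists a+c≡ with m+n≡1+o⇒m≡1+p⊎n≡1+o a a+c≡
  ... | inj₁ (_ , a≡) with leftExistsG a≡
  ...   | x , x∈GL = x ⊕ H , ∈-++⁺ˡ (∈-addL⁺ x∈GL)
  leftExists a+c≡ | inj₂ c≡ with leftExistsH c≡
  ...   | x , x∈HL = G ⊕ x , ∈-++⁺ʳ (addL GL H) (∈-addR⁺ x∈HL)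

  rightMove : g ∈ₗ addL GR H ++ addR G HR → ∃[ k ] (b + d ≡ suc k × Countdown (a + c) k g)
  rightMove g∈ with ∈-++⁻ (addL GR H) g∈
  ... | inj₁ g∈GR+H with ∈-addL⁻ g∈GR+H
  ...   | _ , x∈GR , refl with rightMoveG x∈GR
  ...     | b′ , refl , cx = b′ + d , refl , Countdown-⊕ cx cH
  rightMove g∈ | inj₂ g∈G+HR with ∈-addR⁻ g∈G+HR
  ...   | _ , x∈HR , refl with rightMoveH x∈HR
  ...     | d′ , refl , cx = b + d′ , +-suc b d′ , Countdown-⊕ cG cx

  rightExists : b + d ≡ suc k → ∃[ g ] g ∈ₗ addL GR H ++ addR G HR
  rightExists b+d≡ with m+n≡1+o⇒m≡1+p⊎n≡1+o b b+d≡
  ... | inj₁ (_ , b≡) with rightExistsG b≡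
  ...   | x , x∈GR = x ⊕ H , ∈-++⁺ˡ (∈-addL⁺ x∈GR)
  rightExists b+d≡ | inj₂ d≡ with rightExistsH d≡
  ...   | x , x∈HR = G ⊕ x , ∈-++⁺ʳ (addL GR H) (∈-addR⁺ x∈HR)

Countdown⇒≈ : Countdown a b G → Countdown c d H → a + d ≡ b + c → G ≈ H
Countdown⇒≈ cG cH = Countdown⇒SecondPlayerWin (Countdown-⊕ cG (Countdown-neg cH))

Countdown-natGame : ∀ k → Countdown k 0 (natGame k)
Countdown-natGame zero    = countdown ((λ ()) , λ ()) ((λ ()) , λ ())
Countdown-natGame (suc k) =
  countdown ((λ { (here refl) → k , refl , Countdown-natGame k }) , λ _ → _ , here refl)
            ((λ ()) , λ ())

Countdown-negGame : ∀ k → Countdown 0 (suc k) (negGame k)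
Countdown-negGame zero    =
  countdown ((λ ()) , λ ())
            ((λ { (here refl) → 0 , refl , Countdown-natGame 0 }) , λ _ → _ , here refl)
Countdown-negGame (suc k) =
  countdown ((λ ()) , λ ())
            ((λ { (here refl) → suc k , refl , Countdown-negGame k }) , λ _ → _ , here refl)

Countdown-intGame : ∀ m n → Countdown (m ∸ n) (n ∸ m) (intGame (m ⊖ n))
Countdown-intGame zero    zero    = Countdown-natGame 0
Countdown-intGame (suc m) zero    = Countdown-natGame (suc m)
Countdown-intGame zero    (suc n) = Countdown-negGame n
Countdown-intGame (suc m) (suc n) =
  subst (Countdown (m ∸ n) (n ∸ m) ∘ intGame) (sym ([1+m]⊖[1+n]≡m⊖n m n))
        (Countdown-intGame m n)

m+[n∸m]≡n+[m∸n] : ∀ m n → m + (n ∸ m) ≡ n + (m ∸ n)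
m+[n∸m]≡n+[m∸n] zero    zero    = refl
m+[n∸m]≡n+[m∸n] zero    (suc n) = sym (+-identityʳ (suc n))
m+[n∸m]≡n+[m∸n] (suc m) zero    = +-identityʳ (suc m)
m+[n∸m]≡n+[m∸n] (suc m) (suc n) = cong suc (m+[n∸m]≡n+[m∸n] m n)

∣∁p∣≡1+∣∁[p∪⁅x⁆]∣ : ∀ {n} (p : Subset n) {x : Fin n} → x ∉ p → ∣ ∁ p ∣ ≡ suc ∣ ∁ (p ∪ ⁅ x ⁆) ∣
∣∁p∣≡1+∣∁[p∪⁅x⁆]∣ (outside ∷ p) {zero}  _   = cong (suc ∘ ∣_∣ ∘ ∁) (sym (∪-identityʳ p))
∣∁p∣≡1+∣∁[p∪⁅x⁆]∣ (inside  ∷ p) {zero}  x∉p = ⊥-elim (x∉p here)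
∣∁p∣≡1+∣∁[p∪⁅x⁆]∣ (outside ∷ p) {suc x} x∉p = cong suc (∣∁p∣≡1+∣∁[p∪⁅x⁆]∣ p (x∉p ∘ there))
∣∁p∣≡1+∣∁[p∪⁅x⁆]∣ (inside  ∷ p) {suc x} x∉p = ∣∁p∣≡1+∣∁[p∪⁅x⁆]∣ p (x∉p ∘ there)

∣p∣≡1+k⇒Nonempty : ∀ {k n} {p : Subset n} → ∣ p ∣ ≡ suc k → Nonempty p
∣p∣≡1+k⇒Nonempty {n = n} {p = p} ∣p∣≡ with nonempty? p
... | yes p≢∅ = p≢∅
... | no  p≡∅ = ⊥-elim (0≢1+n (trans (sym (∣⊥∣≡0 n)) (trans (cong ∣_∣ (sym (Empty-unique p≡∅))) ∣p∣≡)))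

∣∁⊥∣≡n : ∀ n → ∣ ∁ (⊥ {n}) ∣ ≡ n
∣∁⊥∣≡n n = trans (∣∁p∣≡n∸∣p∣ (⊥ {n})) (cong (n ∸_) (∣⊥∣≡0 n))

module _ {m n : ℕ} (Δ : LegalComplex m n) {f : ℕ} {A : Subset m} {B : Subset n} where
  open LegalComplex Δ

  ∈-leftOptions⁻ : g ∈ₗ leftOptions (positionGame Δ (suc f) A B) →
    ∃[ i ] (i ∉ A × Face (A ∪ ⁅ i ⁆) B × g ≡ positionGame Δ f (A ∪ ⁅ i ⁆) B)
  ∈-leftOptions⁻ g∈ with ∈-map⁻ (λ i → positionGame Δ f (A ∪ ⁅ i ⁆) B) g∈
  ... | i , i∈ , refl with ∈-filter⁻ (λ i → ¬? (i ∈? A) ×-dec face? (A ∪ ⁅ i ⁆) B) {xs = allFin m} i∈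
  ... | _ , i∉A , face = i , i∉A , face , refl

  ∈-leftOptions⁺ : ∀ {i} → i ∉ A → Face (A ∪ ⁅ i ⁆) B →
    positionGame Δ f (A ∪ ⁅ i ⁆) B ∈ₗ leftOptions (positionGame Δ (suc f) A B)
  ∈-leftOptions⁺ {i} i∉A face =
    ∈-map⁺ (λ i → positionGame Δ f (A ∪ ⁅ i ⁆) B)
      (∈-filter⁺ (λ i → ¬? (i ∈? A) ×-dec face? (A ∪ ⁅ i ⁆) B) (∈-allFin i) (i∉A , face))

  ∈-rightOptions⁻ : g ∈ₗ rightOptions (positionGame Δ (suc f) A B) →
    ∃[ j ] (j ∉ B × Face A (B ∪ ⁅ j ⁆) × g ≡ positionGame Δ f A (B ∪ ⁅ j ⁆))
  ∈-rightOptions⁻ g∈ with ∈-map⁻ (λ j → positionGame Δ f A (B ∪ ⁅ j ⁆)) g∈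
  ... | j , j∈ , refl with ∈-filter⁻ (λ j → ¬? (j ∈? B) ×-dec face? A (B ∪ ⁅ j ⁆)) {xs = allFin n} j∈
  ... | _ , j∉B , face = j , j∉B , face , refl

  ∈-rightOptions⁺ : ∀ {j} → j ∉ B → Face A (B ∪ ⁅ j ⁆) →
    positionGame Δ f A (B ∪ ⁅ j ⁆) ∈ₗ rightOptions (positionGame Δ (suc f) A B)
  ∈-rightOptions⁺ {j} j∉B face =
    ∈-map⁺ (λ j → positionGame Δ f A (B ∪ ⁅ j ⁆))
      (∈-filter⁺ (λ j → ¬? (j ∈? B) ×-dec face? A (B ∪ ⁅ j ⁆)) (∈-allFin j) (j∉B , face))

module _ {m n : ℕ} where
  Countdown-simplexPosition : ∀ f (A : Subset m) (B : Subset n) → ∣ ∁ A ∣ + ∣ ∁ B ∣ ≤ f →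
    Countdown ∣ ∁ A ∣ ∣ ∁ B ∣ (positionGame (simplex m n) f A B)
  Countdown-simplexPosition zero A B exhausted =
    countdown ((λ ()) , ⊥-elim ∘ 0≢1+n ∘ trans (sym noLeft))
              ((λ ()) , ⊥-elim ∘ 0≢1+n ∘ trans (sym noRight))
    where
    noLeft : ∣ ∁ A ∣ ≡ 0
    noLeft = m+n≡0⇒m≡0 _ (n≤0⇒n≡0 exhausted)
    noRight : ∣ ∁ B ∣ ≡ 0
    noRight = m+n≡0⇒n≡0 _ (n≤0⇒n≡0 exhausted)
  Countdown-simplexPosition (suc f) A B fuel =
    countdown (leftMove , leftExists) (rightMove , rightExists)
    where
    Δ : LegalComplex m n
    Δ = simplex m n

    leftMove : g ∈ₗ leftOptions (positionGame Δ (suc f) A B) →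
      ∃[ a′ ] (∣ ∁ A ∣ ≡ suc a′ × Countdown a′ ∣ ∁ B ∣ g)
    leftMove g∈ with ∈-leftOptions⁻ Δ g∈
    ... | i , i∉A , _ , refl =
      _ , oneFewer , Countdown-simplexPosition f _ B (s≤s⁻¹ (subst (λ k → k + ∣ ∁ B ∣ ≤ suc f) oneFewer fuel))
      where
      oneFewer : ∣ ∁ A ∣ ≡ suc ∣ ∁ (A ∪ ⁅ i ⁆) ∣
      oneFewer = ∣∁p∣≡1+∣∁[p∪⁅x⁆]∣ A i∉A

    leftExists : ∣ ∁ A ∣ ≡ suc k → ∃[ g ] g ∈ₗ leftOptions (positionGame Δ (suc f) A B)
    leftExists ∣∁A∣≡ with ∣p∣≡1+k⇒Nonempty ∣∁A∣≡
    ... | _ , i∈∁A = _ , ∈-leftOptions⁺ Δ (x∈∁p⇒x∉p i∈∁A) tt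

    rightMove : g ∈ₗ rightOptions (positionGame Δ (suc f) A B) →
      ∃[ b′ ] (∣ ∁ B ∣ ≡ suc b′ × Countdown ∣ ∁ A ∣ b′ g)
    rightMove g∈ with ∈-rightOptions⁻ Δ g∈
    ... | j , j∉B , _ , refl =
      _ , oneFewer , Countdown-simplexPosition f A _
        (s≤s⁻¹ (subst (_≤ suc f) (+-suc ∣ ∁ A ∣ _) (subst (λ k → ∣ ∁ A ∣ + k ≤ suc f) oneFewer fuel)))
      where
      oneFewer : ∣ ∁ B ∣ ≡ suc ∣ ∁ (B ∪ ⁅ j ⁆) ∣
      oneFewer = ∣∁p∣≡1+∣∁[p∪⁅x⁆]∣ B j∉B

    rightExists : ∣ ∁ B ∣ ≡ suc k → ∃[ g ] g ∈ₗ rightOptions (positionGame Δ (suc f) A B)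
    rightExists ∣∁B∣≡ with ∣p∣≡1+k⇒Nonempty ∣∁B∣≡
    ... | _ , j∈∁B = _ , ∈-rightOptions⁺ Δ (x∈∁p⇒x∉p j∈∁B) tt

Countdown-spGame-simplex : ∀ m n → Countdown m n (spGame (simplex m n))
Countdown-spGame-simplex m n =
  subst₂ (λ a b → Countdown a b (spGame (simplex m n))) (∣∁⊥∣≡n m) (∣∁⊥∣≡n n)
    (Countdown-simplexPosition (m + n) ⊥ ⊥ (≤-reflexive (cong₂ _+_ (∣∁⊥∣≡n m) (∣∁⊥∣≡n n))))

mainTheorem4 : (m n : ℕ) → spGame (simplex m n) ≈ intGame (+ m - + n)
mainTheorem4 m n =
  subst (λ z → spGame (simplex m n) ≈ intGame z) (sym (m-n≡m⊖n m n))
    (Countdown⇒≈ (Countdown-spGame-simplex m n) (Countdown-intGame m n) (m+[n∸m]≡n+[m∸n] m n))
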